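{- For every integer $n\ge0$, $$\sum_{k=0}^{n}\sum_{j=0}^{k}\binom{k}{j}S_1(n,k)B_jB_{k-j}=\sum_{k=0}^{n}(-1)^n\frac{n!}{(k+1)(n-k+1)}.$$
   Context: The (signed) Stirling numbers of the first kind $S_1(n,k)$ are defined by $x(x-1)\cdots(x-n+1)=\sum_{k=0}^nS_1(n,k)x^k$. The Bernoulli numbers $B_n$ are defined by $\frac{t}{e^t-1}=\sum_{n\ge0}B_n\frac{t^n}{n!}$. -}

module Defs where

open import Data.Nat as ℕ using (ℕ; zero; suc)
open import Data.Nat.Combinatorics using (_C_)
open import Data.Nat using (_!)
open import Data.Integer as ℤ using (ℤ)
open import Data.Rational as ℚ using (ℚ; _+_; _*_; -_; _/_; 0ℚ; 1ℚ)
open import Data.List using (List; []; _∷_)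

sumTo : ℕ → (ℕ → ℚ) → ℚ
sumTo zero    f = f 0
sumTo (suc n) f = sumTo n f + f (suc n)

-- Polynomials over ℤ as coefficient lists (constant term first)
Poly : Set
Poly = List ℤ

_⊕_ : Poly → Poly → Poly
[]       ⊕ q        = q
p        ⊕ []       = p
(a ∷ p)  ⊕ (b ∷ q)  = (a ℤ.+ b) ∷ (p ⊕ q)

scale : ℤ → Poly → Poly
scale c []      = []
scale c (a ∷ p) = (c ℤ.* a) ∷ scale c p

mulXminus : ℤ → Poly → Poly
mulXminus c p = (ℤ.0ℤ ∷ p) ⊕ scale (ℤ.- c) p

falling : ℕ → Poly
falling zero    = ℤ.1ℤ ∷ []
falling (suc n) = mulXminus (ℤ.+ n) (falling n)

coeff : Poly → ℕ → ℤ
coeff []      _       = ℤ.0ℤ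
coeff (a ∷ p) zero    = a
coeff (a ∷ p) (suc k) = coeff p k

S₁ : ℕ → ℕ → ℤ
S₁ n k = coeff (falling n) k

ℕ→ℚ : ℕ → ℚ
ℕ→ℚ n = ℤ.+ n / 1

ℤ→ℚ : ℤ → ℚ
ℤ→ℚ z = z ℚ./ 1

-- Bernoulli numbers, t/(e^t-1) = Σ B_n t^n/n!.  Comparing coefficients of
-- t^{m+1}/(m+1)! in (e^t - 1)·Σ B_n t^n/n! = t gives B_0 = 1 and
-- Σ_{j=0}^{m} C(m+1,j) B_j = 0 for m ≥ 1, i.e.
-- B_m = -(1/(m+1)) Σ_{j=0}^{m-1} C(m+1,j) B_j.
private
  Bs : ℕ → List ℚ
  Bs zero    = 1ℚ ∷ []
  Bs (suc m) = (- ((ℤ.+ 1 ℚ./ (2 ℕ.+ m)) * go (Bs m) m)) ∷ Bs m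
    where
    -- list holds B_j for j = i, i-1, ..., 0 ; sum C(m+2, j) B_j
    go : List ℚ → ℕ → ℚ
    go []       _       = 0ℚ
    go (b ∷ bs) i       = ℕ→ℚ ((2 ℕ.+ m) C i) * b + go bs (ℕ.pred i)

  head : List ℚ → ℚ
  head []      = 0ℚ
  head (b ∷ _) = b

B : ℕ → ℚ
B n = head (Bs n)

negOnePow : ℕ → ℚ
negOnePow zero    = 1ℚ
negOnePow (suc n) = - (negOnePow n)

-- Read a sequence u as the moments x^k ↦ u k of a linear functional on ℚ[x]. Then
-- fallingMoment u n = Σ_k S₁(n,k) u_k is that functional applied to the falling factorial
-- (x)_n, and the binomial convolution of two moment sequences is the moment sequence of
-- x + y for independent x and y. Vandermonde's identity (x + y)_n = Σ_i C(n,i) (x)_i (y)_{n-i}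
-- turns the left-hand side into Σ_i C(n,i) Φ(i) Φ(n-i), where Φ = fallingMoment B. The
-- Bernoulli recurrence says that B convolved with the constant sequence 1 is B + δ₁; since
-- (1)_j vanishes for j ≥ 2, applying fallingMoment gives (n+1) Φ(n) = S₁(n+1,1) = (-1)^n n!.
-- Finally C(n,i) i! (n-i)! = n!.
module Submission where

open import Defs
open import Data.Nat as ℕ using (ℕ; zero; suc; _∸_; _!; _≤_; _<_; s≤s)
import Data.Nat.Properties as ℕ
open import Data.Nat.Combinatorics
  using (_C_; nCn≡1; nC1≡n; nCk≡nC[n∸k]; nCk+nC[k+1]≡[n+1]C[k+1]; k![n∸k]!∣n!)
open import Data.Nat.Combinatorics.Specification using (nCk≡n!/k![n-k]!; k>n⇒nCk≡0)
open import Data.Nat.DivMod using (m/n*n≡m)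
open import Data.Nat.Coprimality using (1-coprimeTo)
import Data.Nat.Coprimality as Coprime
open import Data.Integer as ℤ using (+_; -[1+_])
import Data.Integer.Properties as ℤ
open import Data.Rational as ℚ using (ℚ; mkℚ; _+_; _-_; _*_; -_; _/_; 0ℚ; 1ℚ)
import Data.Rational.Properties as ℚ
open import Data.Rational.Solver using (module +-*-Solver)
open +-*-Solver using (solve; _:+_; _:-_; _:*_; :-_; _:=_)
open import Algebra.Properties.Group ℚ.+-0-group using (∙-cancelʳ)
open import Data.List using ([]; _∷_)
open import Function using (const)
open import Relation.Binary.PropositionalEquality
  using (_≡_; refl; sym; trans; cong; cong₂; module ≡-Reasoning)

sumTo-cong : ∀ n {f g : ℕ → ℚ} → (∀ i → i ≤ n → f i ≡ g i) → sumTo n f ≡ sumTo n g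
sumTo-cong zero    f≗g = f≗g 0 ℕ.z≤n
sumTo-cong (suc n) f≗g =
  cong₂ _+_ (sumTo-cong n (λ i i≤n → f≗g i (ℕ.m≤n⇒m≤1+n i≤n))) (f≗g (suc n) ℕ.≤-refl)

sumTo-zero : ∀ n {f : ℕ → ℚ} → (∀ i → i ≤ n → f i ≡ 0ℚ) → sumTo n f ≡ 0ℚ
sumTo-zero zero    f≗0 = f≗0 0 ℕ.z≤n
sumTo-zero (suc n) f≗0 =
  cong₂ _+_ (sumTo-zero n (λ i i≤n → f≗0 i (ℕ.m≤n⇒m≤1+n i≤n))) (f≗0 (suc n) ℕ.≤-refl)

sumTo-suc-zero : ∀ n (f : ℕ → ℚ) → f (suc n) ≡ 0ℚ → sumTo (suc n) f ≡ sumTo n f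
sumTo-suc-zero n f fₙ₊₁≡0 = trans (cong (_+_ (sumTo n f)) fₙ₊₁≡0) (ℚ.+-identityʳ (sumTo n f))

sumTo-suc-head : ∀ n (f : ℕ → ℚ) → sumTo (suc n) f ≡ f 0 + sumTo n (λ i → f (suc i))
sumTo-suc-head zero    f = refl
sumTo-suc-head (suc n) f =
  trans (cong (_+ f (suc (suc n))) (sumTo-suc-head n f)) (ℚ.+-assoc (f 0) _ _)

sumTo-+ : ∀ n (f g : ℕ → ℚ) → sumTo n (λ i → f i + g i) ≡ sumTo n f + sumTo n g
sumTo-+ zero    f g = refl
sumTo-+ (suc n) f g = trans (cong (_+ (f (suc n) + g (suc n))) (sumTo-+ n f g))
  (solve 4 (λ a b c d → (a :+ b) :+ (c :+ d) := (a :+ c) :+ (b :+ d)) refl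
    (sumTo n f) (sumTo n g) (f (suc n)) (g (suc n)))

sumTo-- : ∀ n (f g : ℕ → ℚ) → sumTo n (λ i → f i - g i) ≡ sumTo n f - sumTo n g
sumTo-- zero    f g = refl
sumTo-- (suc n) f g = trans (cong (_+ (f (suc n) - g (suc n))) (sumTo-- n f g))
  (solve 4 (λ a b c d → (a :- b) :+ (c :- d) := (a :+ c) :- (b :+ d)) refl
    (sumTo n f) (sumTo n g) (f (suc n)) (g (suc n)))

sumTo-*ˡ : ∀ n (c : ℚ) (f : ℕ → ℚ) → sumTo n (λ i → c * f i) ≡ c * sumTo n f
sumTo-*ˡ zero    c f = refl
sumTo-*ˡ (suc n) c f =
  trans (cong (_+ c * f (suc n)) (sumTo-*ˡ n c f)) (sym (ℚ.*-distribˡ-+ c _ _))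

-- On numerators over the denominator 1, ℚ's _+_ and _*_ reduce to ℤ→ℚ of the integer
-- result, so the homomorphism laws below hold once both sides are put in this normal form.
ℤ→ℚ≡mkℚ : ∀ z → ℤ→ℚ z ≡ mkℚ z 0 (Coprime.sym (1-coprimeTo ℤ.∣ z ∣))
ℤ→ℚ≡mkℚ (+ n)    = ℚ.normalize-coprime (Coprime.sym (1-coprimeTo n))
ℤ→ℚ≡mkℚ -[1+ n ] = cong -_ (ℚ.normalize-coprime (Coprime.sym (1-coprimeTo (suc n))))

ℤ→ℚ-homo-+ : ∀ a b → ℤ→ℚ (a ℤ.+ b) ≡ ℤ→ℚ a + ℤ→ℚ b
ℤ→ℚ-homo-+ a b = sym (trans (cong₂ _+_ (ℤ→ℚ≡mkℚ a) (ℤ→ℚ≡mkℚ b))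
  (cong ℤ→ℚ (cong₂ ℤ._+_ (ℤ.*-identityʳ a) (ℤ.*-identityʳ b))))

ℤ→ℚ-homo-* : ∀ a b → ℤ→ℚ (a ℤ.* b) ≡ ℤ→ℚ a * ℤ→ℚ b
ℤ→ℚ-homo-* a b = sym (cong₂ _*_ (ℤ→ℚ≡mkℚ a) (ℤ→ℚ≡mkℚ b))

ℤ→ℚ-homo-neg : ∀ a → ℤ→ℚ (ℤ.- a) ≡ - ℤ→ℚ a
ℤ→ℚ-homo-neg (+ zero)  = refl
ℤ→ℚ-homo-neg (+ suc n) = trans (ℤ→ℚ≡mkℚ -[1+ n ]) (sym (cong -_ (ℤ→ℚ≡mkℚ (+ suc n))))
ℤ→ℚ-homo-neg -[1+ n ]  = trans (ℤ→ℚ≡mkℚ (+ suc n)) (sym (cong -_ (ℤ→ℚ≡mkℚ -[1+ n ])))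

ℤ→ℚ-neg-* : ∀ a b → ℤ→ℚ (ℤ.- a ℤ.* b) ≡ - (ℤ→ℚ a * ℤ→ℚ b)
ℤ→ℚ-neg-* a b = begin
  ℤ→ℚ (ℤ.- a ℤ.* b)    ≡⟨ ℤ→ℚ-homo-* (ℤ.- a) b ⟩
  ℤ→ℚ (ℤ.- a) * ℤ→ℚ b  ≡⟨ cong (_* ℤ→ℚ b) (ℤ→ℚ-homo-neg a) ⟩
  - ℤ→ℚ a * ℤ→ℚ b      ≡⟨ ℚ.neg-distribˡ-* (ℤ→ℚ a) (ℤ→ℚ b) ⟨
  - (ℤ→ℚ a * ℤ→ℚ b)    ∎
  where open ≡-Reasoning

ℕ→ℚ-homo-+ : ∀ a b → ℕ→ℚ (a ℕ.+ b) ≡ ℕ→ℚ a + ℕ→ℚ b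
ℕ→ℚ-homo-+ a b = ℤ→ℚ-homo-+ (+ a) (+ b)

ℕ→ℚ-homo-* : ∀ a b → ℕ→ℚ (a ℕ.* b) ≡ ℕ→ℚ a * ℕ→ℚ b
ℕ→ℚ-homo-* a b = trans (cong ℤ→ℚ (ℤ.pos-* a b)) (ℤ→ℚ-homo-* (+ a) (+ b))

[1+m]*1/[1+m]≡1 : ∀ m → ℕ→ℚ (suc m) * (+ 1 / suc m) ≡ 1ℚ
[1+m]*1/[1+m]≡1 m =
  trans (cong₂ _*_ (ℤ→ℚ≡mkℚ (+ suc m)) (ℚ.normalize-coprime (1-coprimeTo (suc m))))
        (ℚ.*-inverseʳ (mkℚ (+ suc m) 0 (Coprime.sym (1-coprimeTo (suc m)))))

coeff-⊕ : ∀ p q k → coeff (p ⊕ q) k ≡ coeff p k ℤ.+ coeff q k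
coeff-⊕ []      q       k       = sym (ℤ.+-identityˡ _)
coeff-⊕ (a ∷ p) []      k       = sym (ℤ.+-identityʳ _)
coeff-⊕ (a ∷ p) (b ∷ q) zero    = refl
coeff-⊕ (a ∷ p) (b ∷ q) (suc k) = coeff-⊕ p q k

coeff-scale : ∀ c p k → coeff (scale c p) k ≡ c ℤ.* coeff p k
coeff-scale c []      k       = sym (ℤ.*-zeroʳ c)
coeff-scale c (a ∷ p) zero    = refl
coeff-scale c (a ∷ p) (suc k) = coeff-scale c p k

coeff-mulXminus : ∀ c p k →
  coeff (mulXminus c p) k ≡ coeff (ℤ.0ℤ ∷ p) k ℤ.+ ℤ.- c ℤ.* coeff p k
coeff-mulXminus c p k = trans (coeff-⊕ (ℤ.0ℤ ∷ p) (scale (ℤ.- c) p) k)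
  (cong (ℤ._+_ (coeff (ℤ.0ℤ ∷ p) k)) (coeff-scale (ℤ.- c) p k))

S₁-vanish : ∀ {n k} → n < k → S₁ n k ≡ ℤ.0ℤ
S₁-vanish {zero}  {suc k} _         = refl
S₁-vanish {suc n} {suc k} (s≤s n<k) = begin
  S₁ (suc n) (suc k)
    ≡⟨ coeff-mulXminus (+ n) (falling n) (suc k) ⟩
  S₁ n k ℤ.+ ℤ.- (+ n) ℤ.* S₁ n (suc k)
    ≡⟨ cong₂ (λ a b → a ℤ.+ ℤ.- (+ n) ℤ.* b) (S₁-vanish n<k) (S₁-vanish (ℕ.m≤n⇒m≤1+n n<k)) ⟩
  ℤ.0ℤ ℤ.+ ℤ.- (+ n) ℤ.* ℤ.0ℤ
    ≡⟨ ℤ.+-identityˡ _ ⟩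
  ℤ.- (+ n) ℤ.* ℤ.0ℤ
    ≡⟨ ℤ.*-zeroʳ (ℤ.- (+ n)) ⟩
  ℤ.0ℤ
    ∎
  where open ≡-Reasoning

s₁ : ℕ → ℕ → ℚ
s₁ n k = ℤ→ℚ (S₁ n k)

s₁-vanish : ∀ {n k} → n < k → s₁ n k ≡ 0ℚ
s₁-vanish n<k = cong ℤ→ℚ (S₁-vanish n<k)

s₁-suc-zero : ∀ n → s₁ (suc n) 0 ≡ - (ℕ→ℚ n * s₁ n 0)
s₁-suc-zero n = begin
  s₁ (suc n) 0
    ≡⟨ cong ℤ→ℚ (coeff-mulXminus (+ n) (falling n) 0) ⟩
  ℤ→ℚ (ℤ.0ℤ ℤ.+ ℤ.- (+ n) ℤ.* S₁ n 0)
    ≡⟨ cong ℤ→ℚ (ℤ.+-identityˡ (ℤ.- (+ n) ℤ.* S₁ n 0)) ⟩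
  ℤ→ℚ (ℤ.- (+ n) ℤ.* S₁ n 0)
    ≡⟨ ℤ→ℚ-neg-* (+ n) (S₁ n 0) ⟩
  - (ℕ→ℚ n * s₁ n 0)
    ∎
  where open ≡-Reasoning

s₁-suc-suc : ∀ n k → s₁ (suc n) (suc k) ≡ s₁ n k - ℕ→ℚ n * s₁ n (suc k)
s₁-suc-suc n k = begin
  s₁ (suc n) (suc k)
    ≡⟨ cong ℤ→ℚ (coeff-mulXminus (+ n) (falling n) (suc k)) ⟩
  ℤ→ℚ (S₁ n k ℤ.+ ℤ.- (+ n) ℤ.* S₁ n (suc k))
    ≡⟨ ℤ→ℚ-homo-+ (S₁ n k) _ ⟩
  s₁ n k + ℤ→ℚ (ℤ.- (+ n) ℤ.* S₁ n (suc k))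
    ≡⟨ cong (_+_ (s₁ n k)) (ℤ→ℚ-neg-* (+ n) (S₁ n (suc k))) ⟩
  s₁ n k - ℕ→ℚ n * s₁ n (suc k)
    ∎
  where open ≡-Reasoning

s₁[1+n,0]≡0 : ∀ n → s₁ (suc n) 0 ≡ 0ℚ
s₁[1+n,0]≡0 zero    = refl
s₁[1+n,0]≡0 (suc n) = begin
  s₁ (suc (suc n)) 0              ≡⟨ s₁-suc-zero (suc n) ⟩
  - (ℕ→ℚ (suc n) * s₁ (suc n) 0)  ≡⟨ cong (λ s → - (ℕ→ℚ (suc n) * s)) (s₁[1+n,0]≡0 n) ⟩
  - (ℕ→ℚ (suc n) * 0ℚ)            ≡⟨ cong -_ (ℚ.*-zeroʳ (ℕ→ℚ (suc n))) ⟩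
  0ℚ                              ∎
  where open ≡-Reasoning

s₁[1+n,1]≡[-1]ⁿn! : ∀ n → s₁ (suc n) 1 ≡ negOnePow n * ℕ→ℚ (n !)
s₁[1+n,1]≡[-1]ⁿn! zero    = refl
s₁[1+n,1]≡[-1]ⁿn! (suc n) = begin
  s₁ (suc (suc n)) 1
    ≡⟨ s₁-suc-suc (suc n) 0 ⟩
  s₁ (suc n) 0 - N * s₁ (suc n) 1
    ≡⟨ cong₂ (λ a b → a - N * b) (s₁[1+n,0]≡0 n) (s₁[1+n,1]≡[-1]ⁿn! n) ⟩
  0ℚ - N * (negOnePow n * ℕ→ℚ (n !))
    ≡⟨ ℚ.+-identityˡ _ ⟩
  - (N * (negOnePow n * ℕ→ℚ (n !)))
    ≡⟨ solve 3 (λ N p f → :- (N :* (p :* f)) := (:- p) :* (N :* f)) refl N (negOnePow n) (ℕ→ℚ (n !)) ⟩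
  - negOnePow n * (N * ℕ→ℚ (n !))
    ≡⟨ cong (- negOnePow n *_) (ℕ→ℚ-homo-* (suc n) (n !)) ⟨
  negOnePow (suc n) * ℕ→ℚ (suc n !)
    ∎
  where
  open ≡-Reasoning
  N = ℕ→ℚ (suc n)

fallingMoment : (ℕ → ℚ) → ℕ → ℚ
fallingMoment u n = sumTo n (λ k → s₁ n k * u k)

shift : (ℕ → ℚ) → ℕ → ℚ
shift u k = u (suc k)

fallingMoment-cong : ∀ n {u v : ℕ → ℚ} → (∀ k → u k ≡ v k) → fallingMoment u n ≡ fallingMoment v n
fallingMoment-cong n u≗v = sumTo-cong n (λ k _ → cong (s₁ n k *_) (u≗v k))

fallingMoment-+ : ∀ n (u v : ℕ → ℚ) →
  fallingMoment (λ k → u k + v k) n ≡ fallingMoment u n + fallingMoment v n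
fallingMoment-+ n u v =
  trans (sumTo-cong n (λ k _ → ℚ.*-distribˡ-+ (s₁ n k) (u k) (v k))) (sumTo-+ n _ _)

fallingMoment-extend : ∀ n (u : ℕ → ℚ) → sumTo (suc n) (λ k → s₁ n k * u k) ≡ fallingMoment u n
fallingMoment-extend n u = sumTo-suc-zero n (λ k → s₁ n k * u k)
  (trans (cong (_* u (suc n)) (s₁-vanish {n} ℕ.≤-refl)) (ℚ.*-zeroˡ (u (suc n))))

-- (x)_{n+1} = x (x)_n - n (x)_n, and multiplying by x shifts the moments.
fallingMoment-suc : ∀ n (u : ℕ → ℚ) →
  fallingMoment u (suc n) ≡ fallingMoment (shift u) n - ℕ→ℚ n * fallingMoment u n
fallingMoment-suc n u = begin
  fallingMoment u (suc n)
    ≡⟨ sumTo-suc-head n (λ k → s₁ (suc n) k * u k) ⟩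
  s₁ (suc n) 0 * u 0 + sumTo n (λ k → s₁ (suc n) (suc k) * u (suc k))
    ≡⟨ cong₂ _+_ (cong (_* u 0) (s₁-suc-zero n)) (sumTo-cong n (λ k _ → split k)) ⟩
  - (N * s₁ n 0) * u 0 + sumTo n (λ k → s₁ n k * u (suc k) - N * (s₁ n (suc k) * u (suc k)))
    ≡⟨ cong (_+_ (- (N * s₁ n 0) * u 0)) (sumTo-- n _ _) ⟩
  - (N * s₁ n 0) * u 0 + (fallingMoment (shift u) n - sumTo n (λ k → N * (s₁ n (suc k) * u (suc k))))
    ≡⟨ cong (λ t → - (N * s₁ n 0) * u 0 + (fallingMoment (shift u) n - t)) (sumTo-*ˡ n N _) ⟩
  - (N * s₁ n 0) * u 0 + (fallingMoment (shift u) n - N * T)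
    ≡⟨ solve 5 (λ N s₀ u₀ A T → (:- (N :* s₀)) :* u₀ :+ (A :- N :* T) := A :- N :* (s₀ :* u₀ :+ T))
         refl N (s₁ n 0) (u 0) (fallingMoment (shift u) n) T ⟩
  fallingMoment (shift u) n - N * (s₁ n 0 * u 0 + T)
    ≡⟨ cong (λ t → fallingMoment (shift u) n - N * t)
         (trans (sym (fallingMoment-extend n u)) (sumTo-suc-head n (λ k → s₁ n k * u k))) ⟨
  fallingMoment (shift u) n - N * fallingMoment u n
    ∎
  where
  open ≡-Reasoning
  N = ℕ→ℚ n
  T = sumTo n (λ k → s₁ n (suc k) * u (suc k))
  split : ∀ k → s₁ (suc n) (suc k) * u (suc k) ≡ s₁ n k * u (suc k) - N * (s₁ n (suc k) * u (suc k))
  split k = trans (cong (_* u (suc k)) (s₁-suc-suc n k))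
    (solve 4 (λ a N b x → (a :- N :* b) :* x := a :* x :- N :* (b :* x)) refl
      (s₁ n k) N (s₁ n (suc k)) (u (suc k)))

binomialSum : ℕ → (ℕ → ℕ → ℚ) → ℚ
binomialSum n F = sumTo n (λ i → ℕ→ℚ (n C i) * F i (n ∸ i))

binomialSum-cong : ∀ n {F G : ℕ → ℕ → ℚ} →
  (∀ i j → i ℕ.+ j ≡ n → F i j ≡ G i j) → binomialSum n F ≡ binomialSum n G
binomialSum-cong n F≗G =
  sumTo-cong n (λ i i≤n → cong (ℕ→ℚ (n C i) *_) (F≗G i (n ∸ i) (ℕ.m+[n∸m]≡n i≤n)))

binomialSum-+ : ∀ n (F G : ℕ → ℕ → ℚ) →
  binomialSum n (λ i j → F i j + G i j) ≡ binomialSum n F + binomialSum n G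
binomialSum-+ n F G =
  trans (sumTo-cong n (λ i _ → ℚ.*-distribˡ-+ (ℕ→ℚ (n C i)) _ _)) (sumTo-+ n _ _)

binomialSum-- : ∀ n (F G : ℕ → ℕ → ℚ) →
  binomialSum n (λ i j → F i j - G i j) ≡ binomialSum n F - binomialSum n G
binomialSum-- n F G = trans (sumTo-cong n (λ i _ → distrib (ℕ→ℚ (n C i)) _ _)) (sumTo-- n _ _)
  where
  distrib : ∀ c a b → c * (a - b) ≡ c * a - c * b
  distrib = solve 3 (λ c a b → c :* (a :- b) := c :* a :- c :* b) refl

binomialSum-*ˡ : ∀ n (c : ℚ) (F : ℕ → ℕ → ℚ) →
  binomialSum n (λ i j → c * F i j) ≡ c * binomialSum n F
binomialSum-*ˡ n c F = trans (sumTo-cong n (λ i _ → commute (ℕ→ℚ (n C i)) _)) (sumTo-*ˡ n c _)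
  where
  commute : ∀ a b → a * (c * b) ≡ c * (a * b)
  commute a b = solve 3 (λ a c b → a :* (c :* b) := c :* (a :* b)) refl a c b

binomialSum-pascal : ∀ n (F : ℕ → ℕ → ℚ) →
  binomialSum (suc n) F ≡ binomialSum n (λ i j → F (suc i) j) + binomialSum n (λ i j → F i (suc j))
binomialSum-pascal n F = begin
  binomialSum (suc n) F
    ≡⟨ sumTo-suc-head n _ ⟩
  F₀ + sumTo n (λ i → ℕ→ℚ (suc n C suc i) * F (suc i) (n ∸ i))
    ≡⟨ cong (_+_ F₀) (trans (sumTo-cong n (λ i _ → pascal i)) (sumTo-+ n _ _)) ⟩
  F₀ + (P + sumTo n Q)
    ≡⟨ solve 3 (λ a p q → a :+ (p :+ q) := p :+ (a :+ q)) refl F₀ P (sumTo n Q) ⟩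
  P + (F₀ + sumTo n Q)
    ≡⟨ cong (_+_ P) shiftedSum ⟩
  P + binomialSum n (λ i j → F i (suc j))
    ∎
  where
  open ≡-Reasoning
  F₀ = ℕ→ℚ 1 * F 0 (suc n)
  P = binomialSum n (λ i j → F (suc i) j)
  Q : ℕ → ℚ
  Q i = ℕ→ℚ (n C suc i) * F (suc i) (n ∸ i)
  pascal : ∀ i → ℕ→ℚ (suc n C suc i) * F (suc i) (n ∸ i) ≡ ℕ→ℚ (n C i) * F (suc i) (n ∸ i) + Q i
  pascal i = begin
    ℕ→ℚ (suc n C suc i) * F (suc i) (n ∸ i)
      ≡⟨ cong (λ c → ℕ→ℚ c * F (suc i) (n ∸ i)) (nCk+nC[k+1]≡[n+1]C[k+1] n i) ⟨
    ℕ→ℚ (n C i ℕ.+ n C suc i) * F (suc i) (n ∸ i)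
      ≡⟨ cong (_* F (suc i) (n ∸ i)) (ℕ→ℚ-homo-+ (n C i) (n C suc i)) ⟩
    (ℕ→ℚ (n C i) + ℕ→ℚ (n C suc i)) * F (suc i) (n ∸ i)
      ≡⟨ ℚ.*-distribʳ-+ (F (suc i) (n ∸ i)) (ℕ→ℚ (n C i)) (ℕ→ℚ (n C suc i)) ⟩
    ℕ→ℚ (n C i) * F (suc i) (n ∸ i) + Q i
      ∎
  lastTerm≡0 : ℕ→ℚ (n C suc n) * F (suc n) (n ∸ n) ≡ 0ℚ
  lastTerm≡0 = trans (cong (λ c → ℕ→ℚ c * F (suc n) (n ∸ n)) (k>n⇒nCk≡0 (ℕ.n<1+n n)))
    (ℚ.*-zeroˡ (F (suc n) (n ∸ n)))
  shiftedSum : F₀ + sumTo n Q ≡ binomialSum n (λ i j → F i (suc j))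
  shiftedSum = begin
    F₀ + sumTo n Q
      ≡⟨ sumTo-suc-head n (λ i → ℕ→ℚ (n C i) * F i (suc n ∸ i)) ⟨
    sumTo (suc n) (λ i → ℕ→ℚ (n C i) * F i (suc n ∸ i))
      ≡⟨ sumTo-suc-zero n _ lastTerm≡0 ⟩
    sumTo n (λ i → ℕ→ℚ (n C i) * F i (suc n ∸ i))
      ≡⟨ sumTo-cong n (λ i i≤n → cong (λ j → ℕ→ℚ (n C i) * F i j) (ℕ.+-∸-assoc 1 i≤n)) ⟩
    binomialSum n (λ i j → F i (suc j))
      ∎

binomialConv : (ℕ → ℚ) → (ℕ → ℚ) → ℕ → ℚ
binomialConv u v n = binomialSum n (λ i j → u i * v j)

fallingMoment-binomialConv : ∀ n (u v : ℕ → ℚ) →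
  fallingMoment (binomialConv u v) n ≡ binomialSum n (λ i j → fallingMoment u i * fallingMoment v j)
fallingMoment-binomialConv zero    u v = trans (ℚ.*-identityˡ _)
  (cong₂ (λ a b → 1ℚ * (a * b)) (sym (ℚ.*-identityˡ (u 0))) (sym (ℚ.*-identityˡ (v 0))))
fallingMoment-binomialConv (suc n) u v = begin
  Φ (binomialConv u v) (suc n)
    ≡⟨ fallingMoment-suc n (binomialConv u v) ⟩
  Φ (shift (binomialConv u v)) n - N * Φ (binomialConv u v) n
    ≡⟨ cong (_- N * Φ (binomialConv u v) n) leibniz ⟩
  Φ (binomialConv (shift u) v) n + Φ (binomialConv u (shift v)) n - N * Φ (binomialConv u v) n
    ≡⟨ cong₂ _-_ (cong₂ _+_ (fallingMoment-binomialConv n (shift u) v)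
                            (fallingMoment-binomialConv n u (shift v)))
                 (trans (cong (N *_) (fallingMoment-binomialConv n u v)) (sym (binomialSum-*ˡ n N Z))) ⟩
  binomialSum n X + binomialSum n Y - binomialSum n (λ i j → N * Z i j)
    ≡⟨ cong (_- binomialSum n (λ i j → N * Z i j)) (binomialSum-+ n X Y) ⟨
  binomialSum n (λ i j → X i j + Y i j) - binomialSum n (λ i j → N * Z i j)
    ≡⟨ binomialSum-- n (λ i j → X i j + Y i j) (λ i j → N * Z i j) ⟨
  binomialSum n (λ i j → X i j + Y i j - N * Z i j)
    ≡⟨ binomialSum-cong n productRule ⟩
  binomialSum n (λ i j → Z (suc i) j + Z i (suc j))
    ≡⟨ binomialSum-+ n (λ i j → Z (suc i) j) (λ i j → Z i (suc j)) ⟩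
  binomialSum n (λ i j → Z (suc i) j) + binomialSum n (λ i j → Z i (suc j))
    ≡⟨ binomialSum-pascal n Z ⟨
  binomialSum (suc n) Z
    ∎
  where
  open ≡-Reasoning
  Φ = fallingMoment
  N = ℕ→ℚ n
  X Y Z : ℕ → ℕ → ℚ
  X i j = Φ (shift u) i * Φ v j
  Y i j = Φ u i * Φ (shift v) j
  Z i j = Φ u i * Φ v j
  leibniz : Φ (shift (binomialConv u v)) n ≡ Φ (binomialConv (shift u) v) n + Φ (binomialConv u (shift v)) n
  leibniz = trans (fallingMoment-cong n (λ k → binomialSum-pascal k (λ i j → u i * v j)))
                  (fallingMoment-+ n (binomialConv (shift u) v) (binomialConv u (shift v)))
  productRule : ∀ i j → i ℕ.+ j ≡ n → X i j + Y i j - N * Z i j ≡ Z (suc i) j + Z i (suc j)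
  productRule i j refl = begin
    X i j + Y i j - ℕ→ℚ (i ℕ.+ j) * Z i j
      ≡⟨ cong (λ w → X i j + Y i j - w * Z i j) (ℕ→ℚ-homo-+ i j) ⟩
    X i j + Y i j - (ℕ→ℚ i + ℕ→ℚ j) * Z i j
      ≡⟨ solve 6 (λ a b a′ b′ I J → a′ :* b :+ a :* b′ :- (I :+ J) :* (a :* b)
                                    := (a′ :- I :* a) :* b :+ a :* (b′ :- J :* b))
           refl (Φ u i) (Φ v j) (Φ (shift u) i) (Φ (shift v) j) (ℕ→ℚ i) (ℕ→ℚ j) ⟩
    (Φ (shift u) i - ℕ→ℚ i * Φ u i) * Φ v j + Φ u i * (Φ (shift v) j - ℕ→ℚ j * Φ v j)
      ≡⟨ cong₂ (λ a b → a * Φ v j + Φ u i * b) (fallingMoment-suc i u) (fallingMoment-suc j v) ⟨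
    Z (suc i) j + Z i (suc j)
      ∎

-- Defs computes B (suc m) through a private accumulator over the list [B m, …, B 0], which
-- cannot be named here; the meta bernoulliAccumulator is solved by unification to it. The
-- `with`s abstract every other occurrence of m so that the constraint is a pattern.
mutual
  bernoulliAccumulator : ℕ → ℕ → ℚ
  bernoulliAccumulator = _

  B-suc-suc-unfold : ∀ m → B (suc (suc m)) ≡
    - (+ 1 / (3 ℕ.+ m) * (ℕ→ℚ ((3 ℕ.+ m) C suc m) * B (suc m) + bernoulliAccumulator (suc m) m))
  B-suc-suc-unfold m with B (suc m)
  ... | _ with + 1 / (3 ℕ.+ m)
  ... | _ with ℕ→ℚ ((3 ℕ.+ m) C suc m)
  ... | _ with suc m
  ... | _ = refl

bernoulliAccumulator≡sumTo : ∀ k i →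
  bernoulliAccumulator k i ≡ sumTo i (λ j → ℕ→ℚ ((2 ℕ.+ k) C j) * B j)
bernoulliAccumulator≡sumTo k zero    = ℚ.+-identityʳ _
bernoulliAccumulator≡sumTo k (suc i) =
  trans (cong (_+_ t) (bernoulliAccumulator≡sumTo k i)) (ℚ.+-comm t _)
  where t = ℕ→ℚ ((2 ℕ.+ k) C suc i) * B (suc i)

B-suc : ∀ m → B (suc m) ≡ - (+ 1 / (2 ℕ.+ m) * sumTo m (λ j → ℕ→ℚ ((2 ℕ.+ m) C j) * B j))
B-suc zero    = refl
B-suc (suc m) = trans (B-suc-suc-unfold m) (cong (λ s → - (+ 1 / (3 ℕ.+ m) * s))
  (trans (cong (_+_ t) (bernoulliAccumulator≡sumTo (suc m) m)) (ℚ.+-comm t _)))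
  where t = ℕ→ℚ ((3 ℕ.+ m) C suc m) * B (suc m)

[1+n]Cn≡1+n : ∀ n → suc n C n ≡ suc n
[1+n]Cn≡1+n n =
  trans (nCk≡nC[n∸k] (ℕ.n≤1+n n)) (trans (cong (suc n C_) (ℕ.m+n∸n≡m 1 n)) (nC1≡n (suc n)))

B-recurrence : ∀ m → sumTo (suc m) (λ j → ℕ→ℚ ((2 ℕ.+ m) C j) * B j) ≡ 0ℚ
B-recurrence m = begin
  S + ℕ→ℚ ((2 ℕ.+ m) C suc m) * B (suc m)
    ≡⟨ cong₂ (λ c b → S + ℕ→ℚ c * b) ([1+n]Cn≡1+n (suc m)) (B-suc m) ⟩
  S + K * - (c * S)
    ≡⟨ solve 3 (λ S K c → S :+ K :* (:- (c :* S)) := S :- (K :* c) :* S) refl S K c ⟩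
  S - (K * c) * S
    ≡⟨ cong (λ x → S - x * S) ([1+m]*1/[1+m]≡1 (suc m)) ⟩
  S - 1ℚ * S
    ≡⟨ cong (_-_ S) (ℚ.*-identityˡ S) ⟩
  S - S
    ≡⟨ ℚ.+-inverseʳ S ⟩
  0ℚ
    ∎
  where
  open ≡-Reasoning
  S = sumTo m (λ j → ℕ→ℚ ((2 ℕ.+ m) C j) * B j)
  K = ℕ→ℚ (2 ℕ.+ m)
  c = + 1 / (2 ℕ.+ m)

δ₁ : ℕ → ℚ
δ₁ 1 = 1ℚ
δ₁ _ = 0ℚ

binomialConv-B-one : ∀ k → binomialConv B (const 1ℚ) k ≡ B k + δ₁ k
binomialConv-B-one zero          = refl
binomialConv-B-one (suc zero)    = refl
binomialConv-B-one (suc (suc m)) = begin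
  sumTo (suc m) g + g (suc (suc m))  ≡⟨ cong₂ _+_ lowerTerms lastTerm ⟩
  0ℚ + B (suc (suc m))               ≡⟨ ℚ.+-comm 0ℚ (B (suc (suc m))) ⟩
  B (suc (suc m)) + 0ℚ               ∎
  where
  open ≡-Reasoning
  g : ℕ → ℚ
  g j = ℕ→ℚ ((2 ℕ.+ m) C j) * (B j * 1ℚ)
  lowerTerms : sumTo (suc m) g ≡ 0ℚ
  lowerTerms = trans (sumTo-cong (suc m) (λ j _ → cong (ℕ→ℚ ((2 ℕ.+ m) C j) *_) (ℚ.*-identityʳ (B j))))
    (B-recurrence m)
  lastTerm : g (suc (suc m)) ≡ B (suc (suc m))
  lastTerm = trans (cong₂ (λ c b → ℕ→ℚ c * b) (nCn≡1 (2 ℕ.+ m)) (ℚ.*-identityʳ (B (suc (suc m)))))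
    (ℚ.*-identityˡ _)

fallingMoment-one : ∀ n → fallingMoment (const 1ℚ) (suc (suc n)) ≡ 0ℚ
fallingMoment-one zero    = refl
fallingMoment-one (suc n) = begin
  Φ₁ (suc (suc (suc n)))                   ≡⟨ fallingMoment-suc (suc (suc n)) (const 1ℚ) ⟩
  Φ₁ (suc (suc n)) - N * Φ₁ (suc (suc n))  ≡⟨ cong (λ x → x - N * x) (fallingMoment-one n) ⟩
  0ℚ - N * 0ℚ                              ≡⟨ cong (_-_ 0ℚ) (ℚ.*-zeroʳ N) ⟩
  0ℚ                                       ∎
  where
  open ≡-Reasoning
  Φ₁ = fallingMoment (const 1ℚ)
  N = ℕ→ℚ (suc (suc n))

fallingMoment-δ₁ : ∀ m → fallingMoment δ₁ (suc m) ≡ s₁ (suc m) 1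
fallingMoment-δ₁ m = pick m (s₁ (suc m))
  where
  pick : ∀ m (g : ℕ → ℚ) → sumTo (suc m) (λ k → g k * δ₁ k) ≡ g 1
  pick zero    g = trans (cong₂ _+_ (ℚ.*-zeroʳ (g 0)) (ℚ.*-identityʳ (g 1))) (ℚ.+-identityˡ (g 1))
  pick (suc m) g = trans (sumTo-suc-zero (suc m) _ (ℚ.*-zeroʳ (g (suc (suc m))))) (pick m g)

binomialSum-fallingMoment-one : ∀ m (x : ℕ → ℚ) →
  binomialSum (suc m) (λ i j → x i * fallingMoment (const 1ℚ) j) ≡ ℕ→ℚ (suc m) * x m + x (suc m)
binomialSum-fallingMoment-one m x = cong₂ _+_ (allButLast m) lastTerm
  where
  Φ₁ = fallingMoment (const 1ℚ)
  lastTerm : ℕ→ℚ (suc m C suc m) * (x (suc m) * Φ₁ (m ∸ m)) ≡ x (suc m)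
  lastTerm = trans (cong₂ (λ c j → ℕ→ℚ c * (x (suc m) * Φ₁ j)) (nCn≡1 (suc m)) (ℕ.n∸n≡0 m))
    (trans (ℚ.*-identityˡ _) (ℚ.*-identityʳ (x (suc m))))
  allButLast : ∀ m → sumTo m (λ i → ℕ→ℚ (suc m C i) * (x i * Φ₁ (suc m ∸ i))) ≡ ℕ→ℚ (suc m) * x m
  allButLast zero    = cong (ℕ→ℚ 1 *_) (ℚ.*-identityʳ (x 0))
  allButLast (suc m) = trans (cong₂ _+_ (sumTo-zero m vanishing) penultimate) (ℚ.+-identityˡ _)
    where
    c : ℕ → ℚ
    c i = ℕ→ℚ (suc (suc m) C i)
    vanishing : ∀ i → i ≤ m → c i * (x i * Φ₁ (suc (suc m) ∸ i)) ≡ 0ℚ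
    vanishing i i≤m = begin
      c i * (x i * Φ₁ (suc (suc m) ∸ i))     ≡⟨ cong (λ j → c i * (x i * Φ₁ j)) (ℕ.+-∸-assoc 2 i≤m) ⟩
      c i * (x i * Φ₁ (suc (suc (m ∸ i))))   ≡⟨ cong (λ y → c i * (x i * y)) (fallingMoment-one (m ∸ i)) ⟩
      c i * (x i * 0ℚ)                       ≡⟨ cong (c i *_) (ℚ.*-zeroʳ (x i)) ⟩
      c i * 0ℚ                               ≡⟨ ℚ.*-zeroʳ (c i) ⟩
      0ℚ                                     ∎
      where open ≡-Reasoning
    penultimate : c (suc m) * (x (suc m) * Φ₁ (suc (suc m) ∸ suc m)) ≡ ℕ→ℚ (suc (suc m)) * x (suc m)
    penultimate = cong₂ (λ c y → ℕ→ℚ c * y) ([1+n]Cn≡1+n (suc m))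
      (trans (cong (λ j → x (suc m) * Φ₁ j) (ℕ.m+n∸n≡m 1 m)) (ℚ.*-identityʳ (x (suc m))))

[1+m]*fallingMoment-B : ∀ m → ℕ→ℚ (suc m) * fallingMoment B m ≡ s₁ (suc m) 1
[1+m]*fallingMoment-B m = ∙-cancelʳ (Φ B (suc m)) _ _ (begin
  ℕ→ℚ (suc m) * Φ B m + Φ B (suc m)
    ≡⟨ binomialSum-fallingMoment-one m (Φ B) ⟨
  binomialSum (suc m) (λ i j → Φ B i * Φ (const 1ℚ) j)
    ≡⟨ fallingMoment-binomialConv (suc m) B (const 1ℚ) ⟨
  Φ (binomialConv B (const 1ℚ)) (suc m)
    ≡⟨ fallingMoment-cong (suc m) binomialConv-B-one ⟩
  Φ (λ k → B k + δ₁ k) (suc m)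
    ≡⟨ fallingMoment-+ (suc m) B δ₁ ⟩
  Φ B (suc m) + Φ δ₁ (suc m)
    ≡⟨ cong (_+_ (Φ B (suc m))) (fallingMoment-δ₁ m) ⟩
  Φ B (suc m) + s₁ (suc m) 1
    ≡⟨ ℚ.+-comm (Φ B (suc m)) (s₁ (suc m) 1) ⟩
  s₁ (suc m) 1 + Φ B (suc m)
    ∎)
  where
  open ≡-Reasoning
  Φ = fallingMoment

fallingMoment-B : ∀ m → fallingMoment B m ≡ + 1 / suc m * (negOnePow m * ℕ→ℚ (m !))
fallingMoment-B m = begin
  Φ                                ≡⟨ ℚ.*-identityˡ Φ ⟨
  1ℚ * Φ                           ≡⟨ cong (_* Φ) (trans (ℚ.*-comm c K) ([1+m]*1/[1+m]≡1 m)) ⟨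
  (c * K) * Φ                      ≡⟨ ℚ.*-assoc c K Φ ⟩
  c * (K * Φ)                      ≡⟨ cong (c *_) (trans ([1+m]*fallingMoment-B m) (s₁[1+n,1]≡[-1]ⁿn! m)) ⟩
  c * (negOnePow m * ℕ→ℚ (m !))    ∎
  where
  open ≡-Reasoning
  Φ = fallingMoment B m
  c = + 1 / suc m
  K = ℕ→ℚ (suc m)

negOnePow-+ : ∀ a b → negOnePow (a ℕ.+ b) ≡ negOnePow a * negOnePow b
negOnePow-+ zero    b = sym (ℚ.*-identityˡ _)
negOnePow-+ (suc a) b =
  trans (cong -_ (negOnePow-+ a b)) (ℚ.neg-distribˡ-* (negOnePow a) (negOnePow b))

nCk*[k!*[n∸k]!]≡n! : ∀ {n k} → k ≤ n → (n C k) ℕ.* (k ! ℕ.* (n ∸ k) !) ≡ n !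
nCk*[k!*[n∸k]!]≡n! {n} {k} k≤n =
  trans (cong (λ c → c ℕ.* (k ! ℕ.* (n ∸ k) !)) (nCk≡n!/k![n-k]! k≤n))
        (m/n*n≡m {{k ℕ.!* (n ∸ k) !≢0}} (k![n∸k]!∣n! k≤n))

nCi*fallingMoment-B : ∀ {n i} → i ≤ n →
  ℕ→ℚ (n C i) * (fallingMoment B i * fallingMoment B (n ∸ i))
    ≡ negOnePow n * (ℕ→ℚ (n !) * (+ 1 / suc i * (+ 1 / suc (n ∸ i))))
nCi*fallingMoment-B {n} {i} i≤n = begin
  ℕ→ℚ (n C i) * (fallingMoment B i * fallingMoment B (n ∸ i))
    ≡⟨ cong₂ (λ a b → ℕ→ℚ (n C i) * (a * b)) (fallingMoment-B i) (fallingMoment-B (n ∸ i)) ⟩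
  ℕ→ℚ (n C i) * ((x * (p * f)) * (y * (p′ * f′)))
    ≡⟨ solve 7 (λ c x p f y p′ f′ → c :* ((x :* (p :* f)) :* (y :* (p′ :* f′)))
                                     := (p :* p′) :* ((c :* (f :* f′)) :* (x :* y)))
         refl (ℕ→ℚ (n C i)) x p f y p′ f′ ⟩
  (p * p′) * ((ℕ→ℚ (n C i) * (f * f′)) * (x * y))
    ≡⟨ cong₂ (λ a b → a * ((ℕ→ℚ (n C i) * b) * (x * y)))
         (negOnePow-+ i (n ∸ i)) (ℕ→ℚ-homo-* (i !) ((n ∸ i) !)) ⟨
  negOnePow (i ℕ.+ (n ∸ i)) * ((ℕ→ℚ (n C i) * ℕ→ℚ (i ! ℕ.* (n ∸ i) !)) * (x * y))
    ≡⟨ cong (λ c → negOnePow (i ℕ.+ (n ∸ i)) * (c * (x * y))) (ℕ→ℚ-homo-* (n C i) (i ! ℕ.* (n ∸ i) !)) ⟨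
  negOnePow (i ℕ.+ (n ∸ i)) * (ℕ→ℚ ((n C i) ℕ.* (i ! ℕ.* (n ∸ i) !)) * (x * y))
    ≡⟨ cong₂ (λ a b → negOnePow a * (ℕ→ℚ b * (x * y))) (ℕ.m+[n∸m]≡n i≤n) (nCk*[k!*[n∸k]!]≡n! i≤n) ⟩
  negOnePow n * (ℕ→ℚ (n !) * (x * y))
    ∎
  where
  open ≡-Reasoning
  x = + 1 / suc i
  y = + 1 / suc (n ∸ i)
  p = negOnePow i
  p′ = negOnePow (n ∸ i)
  f = ℕ→ℚ (i !)
  f′ = ℕ→ℚ ((n ∸ i) !)

mainTheorem10 : (n : ℕ) →
    sumTo n (λ k → sumTo k (λ j →
        ℕ→ℚ (k C j) * ℤ→ℚ (S₁ n k) * B j * B (k ∸ j)))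
    ≡ sumTo n (λ k →
        negOnePow n * (ℕ→ℚ (n !) * ((+ 1) / (suc k) * ((+ 1) / (suc (n ∸ k))))))
mainTheorem10 n = begin
  sumTo n (λ k → sumTo k (λ j → ℕ→ℚ (k C j) * s₁ n k * B j * B (k ∸ j)))
    ≡⟨ sumTo-cong n (λ k _ → factorStirling k) ⟩
  fallingMoment (binomialConv B B) n
    ≡⟨ fallingMoment-binomialConv n B B ⟩
  binomialSum n (λ i j → fallingMoment B i * fallingMoment B j)
    ≡⟨ sumTo-cong n (λ i → nCi*fallingMoment-B) ⟩
  sumTo n (λ k → negOnePow n * (ℕ→ℚ (n !) * (+ 1 / suc k * (+ 1 / suc (n ∸ k)))))
    ∎
  where
  open ≡-Reasoning
  pullOut : ∀ c s a b → c * s * a * b ≡ s * (c * (a * b))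
  pullOut = solve 4 (λ c s a b → c :* s :* a :* b := s :* (c :* (a :* b))) refl
  factorStirling : ∀ k →
    sumTo k (λ j → ℕ→ℚ (k C j) * s₁ n k * B j * B (k ∸ j)) ≡ s₁ n k * binomialConv B B k
  factorStirling k = trans (sumTo-cong k (λ j _ → pullOut (ℕ→ℚ (k C j)) (s₁ n k) (B j) (B (k ∸ j))))
                           (sumTo-*ˡ k (s₁ n k) _)
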